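{- Let $a$ be a fixed positive integer. Then the set of positive integers $b$ with $r(a,b)\le 1$ has positive proportion, i.e. $$\liminf_{N\to\infty}\frac{\#\{1\le b\le N:\ r(a,b)\le 1\}}{N}>0.$$
   Context: $\phi$ denotes Euler's totient function. For positive integers $a,b$, $c(a,b)$ is defined as the least positive integer $c$ such that $\phi(a!)\phi(b!)$ divides $\phi(c!)$, and $r(a,b)=c(a,b)/(a+b)$. -}

module Defs where

open import Data.Nat using (ℕ; zero; suc; _+_; _*_; _≤_; _<_; _!)
open import Data.Nat.Divisibility using (_∣_)
open import Data.Nat.Coprimality using (coprime?)
open import Data.List using (List; length; filter; applyUpTo)
open import Data.Product using (_×_; ∃)
open import Relation.Nullary using (¬_)

φ : ℕ → ℕ
φ n = length (filter (λ k → coprime? k n) (applyUpTo suc n))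

Cond : ℕ → ℕ → ℕ → Set
Cond a b c = φ (a !) * φ (b !) ∣ φ (c !)

IsC : ℕ → ℕ → ℕ → Set
IsC a b c = (1 ≤ c) × Cond a b c × (∀ c′ → 1 ≤ c′ → c′ < c → ¬ Cond a b c′)

-- r(a,b) = c(a,b)/(a+b) ≤ 1, i.e. c(a,b) ≤ a + b
RLeOne : ℕ → ℕ → Set
RLeOne a b = ∃ λ c → IsC a b c × c ≤ a + b

-- If b + 1 is even, at least 4 and divisible by φ(a!), then every prime factor of b + 1
-- already divides b!, so φ((b+1)!) = (b+1) φ(b!) is divisible by φ(a!) φ(b!), whence
-- c(a,b) ≤ b + 1 ≤ a + b.  All b ≡ −1 modulo 4 φ(a!) qualify, and they have density
-- 1 / (4 φ(a!)).
module Submission where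

open import Defs
open import Data.Nat
open import Data.Nat.Properties
open import Data.Nat.Divisibility
open import Data.Nat.Tactic.RingSolver using (solve-∀)
open import Data.Nat.Coprimality using (Coprime; coprime?; coprime-+; coprime-divisor; 1-coprimeTo)
open import Data.Nat.DivMod using (_/_; _%_; m≡m%n+[m/n]*n; m%n<n; m≥n⇒m/n>0; m/n*n≤m)
open import Data.List using (List; _∷_; _++_; length; filter; applyUpTo)
open import Data.List.Properties using (length-++; filter-++; filter-accept; length-applyUpTo)
open import Data.List.Relation.Unary.All using (All)
open import Data.List.Relation.Unary.All.Properties using (applyUpTo⁺₁)
open import Data.List.Relation.Unary.Unique.Propositional using (Unique)
import Data.List.Relation.Unary.Unique.Propositional.Properties as Unique
open import Data.Product using (Σ; _×_; _,_; ∃)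
open import Function using (_∘_; _⇔_; mk⇔; Equivalence)
open import Level using (Level)
open import Relation.Nullary using (¬_; yes; no; _×-dec_; contradiction)
open import Relation.Unary using (Pred; Decidable)
open import Relation.Binary.PropositionalEquality

private
  variable
    ℓ ℓ′ : Level

∃-least : ∀ {P : Pred ℕ ℓ} → Decidable P → ∀ n → (∃ λ c → c ≤ n × P c) →
          ∃ λ c → c ≤ n × P c × (∀ {c′} → c′ < c → ¬ P c′)
∃-least P? zero (c , c≤0 , Pc) = c , c≤0 , Pc , λ c′<c _ → n≮0 (<-≤-trans c′<c c≤0)
∃-least P? (suc n) (c , c≤1+n , Pc) with anyUpTo? P? (suc n)
... | no none = c , c≤1+n , Pc , λ c′<c Pc′ → none (_ , <-≤-trans c′<c c≤1+n , Pc′)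
... | yes (c′ , s≤s c′≤n , Pc′) with ∃-least P? n (c′ , c′≤n , Pc′)
...   | d , d≤n , Pd , least = d , m≤n⇒m≤1+n d≤n , Pd , least

count : {P : Pred ℕ ℓ} → Decidable P → (ℕ → ℕ) → ℕ → ℕ
count P? f n = length (filter P? (applyUpTo f n))

count-cong : ∀ {P : Pred ℕ ℓ} {Q : Pred ℕ ℓ′} (P? : Decidable P) (Q? : Decidable Q) {f g} n →
             (∀ i → P (f i) ⇔ Q (g i)) → count P? f n ≡ count Q? g n
count-cong P? Q? zero    P⇔Q = refl
count-cong P? Q? {f} {g} (suc n) P⇔Q with P? (f 0) | Q? (g 0)
... | yes _  | yes _  = cong suc (count-cong P? Q? n (P⇔Q ∘ suc))
... | no _   | no _   = count-cong P? Q? n (P⇔Q ∘ suc)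
... | yes p  | no ¬q  = contradiction (Equivalence.to (P⇔Q 0) p) ¬q
... | no ¬p  | yes q  = contradiction (Equivalence.from (P⇔Q 0) q) ¬p

applyUpTo-+ : ∀ {A : Set ℓ} (f : ℕ → A) m n →
              applyUpTo f (m + n) ≡ applyUpTo f m ++ applyUpTo (f ∘ (m +_)) n
applyUpTo-+ f zero    n = refl
applyUpTo-+ f (suc m) n = cong (f 0 ∷_) (applyUpTo-+ (f ∘ suc) m n)

module _ {P : Pred ℕ ℓ} (P? : Decidable P) where

  count-+ : ∀ f m n → count P? f (m + n) ≡ count P? f m + count P? (f ∘ (m +_)) n
  count-+ f m n = begin
    length (filter P? (applyUpTo f (m + n)))  ≡⟨ cong (length ∘ filter P?) (applyUpTo-+ f m n) ⟩
    length (filter P? (xs ++ ys))             ≡⟨ cong length (filter-++ P? xs ys) ⟩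
    length (filter P? xs ++ filter P? ys)     ≡⟨ length-++ (filter P? xs) ⟩
    count P? f m + count P? (f ∘ (m +_)) n    ∎
    where
    open ≡-Reasoning
    xs ys : List ℕ
    xs = applyUpTo f m
    ys = applyUpTo (f ∘ (m +_)) n

  count-periodic : ∀ f m → (∀ i → P (f (m + i)) ⇔ P (f i)) →
                   ∀ k → count P? f (k * m) ≡ k * count P? f m
  count-periodic f m periodic zero    = refl
  count-periodic f m periodic (suc k) = begin
    count P? f (m + k * m)              ≡⟨ count-+ f m (k * m) ⟩
    count P? f m + count P? f′ (k * m)  ≡⟨ cong (count P? f m +_) shifted-blocks ⟩
    count P? f m + k * count P? f′ m    ≡⟨ cong (λ c → count P? f m + k * c) shift-invariant ⟩
    count P? f m + k * count P? f m     ∎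
    where
    open ≡-Reasoning
    f′ : ℕ → ℕ
    f′ = f ∘ (m +_)
    shifted-blocks : count P? f′ (k * m) ≡ k * count P? f′ m
    shifted-blocks = count-periodic f′ m (periodic ∘ (m +_)) k
    shift-invariant : count P? f′ m ≡ count P? f m
    shift-invariant = count-cong P? P? m periodic

coprime-∣ : ∀ {x k m} → k ∣ m → Coprime x m → Coprime x k
coprime-∣ k∣m x⊥m (d∣x , d∣k) = x⊥m (d∣x , ∣-trans d∣k k∣m)

coprime-* : ∀ {x k m} → Coprime x k → Coprime x m → Coprime x (k * m)
coprime-* {x} {k} x⊥k x⊥m {d} (d∣x , d∣km) = x⊥m (d∣x , coprime-divisor d⊥k d∣km)
  where
  d⊥k : Coprime d k
  d⊥k (e∣d , e∣k) = x⊥k (∣-trans e∣d d∣x , e∣k)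

coprime-+-⇔ : ∀ m x → Coprime (m + x) m ⇔ Coprime x m
coprime-+-⇔ m x = mk⇔ m+x⊥m⇒x⊥m coprime-+
  where
  m+x⊥m⇒x⊥m : Coprime (m + x) m → Coprime x m
  m+x⊥m⇒x⊥m m+x⊥m (d∣x , d∣m) = m+x⊥m (∣m∣n⇒∣m+n d∣m d∣x , d∣m)

φ-positive : ∀ {n} → 1 ≤ n → 1 ≤ φ n
φ-positive {suc n} _ =
  subst (1 ≤_) (sym (cong length (filter-accept (λ k → coprime? k (suc n)) (1-coprimeTo (suc n)))))
        (s≤s z≤n)

-- The hypothesis says that every prime factor of k divides m.
φ-* : ∀ k m → (∀ {x} → Coprime x m → Coprime x k) → φ (k * m) ≡ k * φ m
φ-* k m coprime-m⇒coprime-k = begin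
  φ (k * m)
    ≡⟨ count-cong (coprimeTo? (k * m)) (coprimeTo? m) (k * m) (same-units ∘ suc) ⟩
  count (coprimeTo? m) suc (k * m)
    ≡⟨ count-periodic (coprimeTo? m) suc m periodic k ⟩
  k * φ m
    ∎
  where
  open ≡-Reasoning
  coprimeTo? : ∀ n → Decidable (λ x → Coprime x n)
  coprimeTo? n x = coprime? x n
  same-units : ∀ x → Coprime x (k * m) ⇔ Coprime x m
  same-units _ = mk⇔ (coprime-∣ (n∣m*n k)) (λ x⊥m → coprime-* (coprime-m⇒coprime-k x⊥m) x⊥m)
  periodic : ∀ i → Coprime (suc (m + i)) m ⇔ Coprime (suc i) m
  periodic i = subst (λ y → Coprime y m ⇔ Coprime (suc i) m) (+-suc m i) (coprime-+-⇔ m (suc i))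

m≤n⇒m∣n! : ∀ {m n} .{{_ : NonZero m}} → m ≤ n → m ∣ n !
m≤n⇒m∣n! {suc k} k<n = ∣-trans (m∣m*n (k !)) (m≤n⇒m!∣n! k<n)

coprime-n!⇒coprime-1+n : ∀ {x n} → 2 ∣ suc n → 2 ≤ n → Coprime x (n !) → Coprime x (suc n)
coprime-n!⇒coprime-1+n {x} {n} (divides (suc e) 1+n≡1+e*2) 2≤n x⊥n! =
  subst (Coprime x) (sym 1+n≡1+e*2) (coprime-* (coprime-∣ (m≤n⇒m∣n! 1+e≤n) x⊥n!)
                                               (coprime-∣ (m≤n⇒m∣n! 2≤n) x⊥n!))
  where
  1+e≤n : suc e ≤ n
  1+e≤n = subst (suc e ≤_) (sym (suc-injective 1+n≡1+e*2)) (s≤s (m≤m*n e 2))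

φ-[1+n]! : ∀ {n} → 2 ∣ suc n → 2 ≤ n → φ (suc n !) ≡ suc n * φ (n !)
φ-[1+n]! {n} 2∣1+n 2≤n = φ-* (suc n) (n !) (coprime-n!⇒coprime-1+n 2∣1+n 2≤n)

Cond⇒RLeOne : ∀ {a b c} → 1 ≤ c → c ≤ a + b → Cond a b c → RLeOne a b
Cond⇒RLeOne {a} {b} {c} 1≤c c≤a+b cond =
  let c₀ , c₀≤c , (1≤c₀ , cond₀) , least = ∃-least Cond⁺? c (c , ≤-refl , 1≤c , cond)
  in c₀ , (1≤c₀ , cond₀ , λ c′ 1≤c′ c′<c₀ cond′ → least c′<c₀ (1≤c′ , cond′))
        , ≤-trans c₀≤c c≤a+b
  where
  Cond⁺? : Decidable (λ c → 1 ≤ c × Cond a b c)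
  Cond⁺? c = (1 ≤? c) ×-dec (φ (a !) * φ (b !) ∣? φ (c !))

φ[a!]∣1+b⇒RLeOne : ∀ {a b} → 1 ≤ a → φ (a !) ∣ suc b → 2 ∣ suc b → 2 ≤ b → RLeOne a b
φ[a!]∣1+b⇒RLeOne {a} {b} 1≤a φ[a!]∣1+b 2∣1+b 2≤b =
  Cond⇒RLeOne {a} {b} (s≤s z≤n) (+-monoˡ-≤ b 1≤a) cond
  where
  cond : Cond a b (suc b)
  cond = subst (φ (a !) * φ (b !) ∣_) (sym (φ-[1+n]! 2∣1+b 2≤b))
               (*-monoˡ-∣ (φ (b !)) φ[a!]∣1+b)

HasPositiveLowerDensity : Pred ℕ ℓ → Set ℓ
HasPositiveLowerDensity P = Σ ℕ λ k → 1 ≤ k × Σ ℕ λ N₀ → (N : ℕ) → N₀ ≤ N →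
  Σ (List ℕ) λ bs → Unique bs × All (λ b → (1 ≤ b × b ≤ N) × P b) bs × N ≤ k * length bs

-1-mod-density : ∀ {P : Pred ℕ ℓ} L → 2 ≤ L → (∀ {b} → L ∣ suc b → P b) →
                 HasPositiveLowerDensity P
-1-mod-density {P = P} L@(suc m) (s≤s 1≤m) L∣1+b⇒P = 2 * L , s≤s z≤n , L , witnesses
  where
  -- chosen so that suc (b i) reduces to suc i * L
  b : ℕ → ℕ
  b i = m + i * L

  b-increasing : ∀ {i j} → i < j → b i < b j
  b-increasing i<j = +-monoʳ-< m (*-monoˡ-< L i<j)

  witnesses : (N : ℕ) → L ≤ N →
              Σ (List ℕ) λ bs → Unique bs × All (λ b → (1 ≤ b × b ≤ N) × P b) bs ×
                                N ≤ 2 * L * length bs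
  witnesses N L≤N = applyUpTo b T
                  , Unique.applyUpTo⁺₁ b T (λ i<j _ → <⇒≢ (b-increasing i<j))
                  , applyUpTo⁺₁ b T good
                  , bound
    where
    T : ℕ
    T = N / L

    good : ∀ {i} → i < T → (1 ≤ b i × b i ≤ N) × P (b i)
    good {i} i<T = (≤-trans 1≤m (m≤m+n m (i * L)) , <⇒≤ b<N) , L∣1+b⇒P (divides (suc i) refl)
      where
      b<N : b i < N
      b<N = ≤-trans (*-monoˡ-≤ L i<T) (m/n*n≤m N L)

    bound : N ≤ 2 * L * length (applyUpTo b T)
    bound = begin
      N                               ≡⟨ m≡m%n+[m/n]*n N L ⟩
      N % L + T * L                   <⟨ +-monoˡ-< (T * L) (m%n<n N L) ⟩
      suc T * L                       ≤⟨ *-monoˡ-≤ L (+-monoˡ-≤ T (m≥n⇒m/n>0 L≤N)) ⟩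
      (T + T) * L                     ≡⟨ rearrange T L ⟩
      2 * L * T                       ≡⟨ cong (2 * L *_) (length-applyUpTo b T) ⟨
      2 * L * length (applyUpTo b T)  ∎
      where
      open ≤-Reasoning
      rearrange : ∀ x y → (x + x) * y ≡ 2 * y * x
      rearrange = solve-∀

proposition4p2 : (a : ℕ) → 1 ≤ a →
    Σ ℕ λ k → 1 ≤ k × Σ ℕ λ N₀ → (N : ℕ) → N₀ ≤ N →
      Σ (List ℕ) λ bs → Unique bs ×
        All (λ b → (1 ≤ b × b ≤ N) × RLeOne a b) bs ×
        N ≤ k * length bs
proposition4p2 a 1≤a = -1-mod-density L (≤-trans (m≤m+n 2 2) 4≤L) good
  where
  q L : ℕ
  q = φ (a !)
  L = 4 * q

  4≤L : 4 ≤ L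
  4≤L = *-monoʳ-≤ 4 (φ-positive (1≤n! a))

  good : ∀ {b} → L ∣ suc b → RLeOne a b
  good {b} L∣1+b = φ[a!]∣1+b⇒RLeOne 1≤a (∣-trans (n∣m*n 4) L∣1+b) (∣-trans 2∣L L∣1+b) 2≤b
    where
    2∣L : 2 ∣ L
    2∣L = ∣-trans (divides 2 refl) (m∣m*n q)
    2≤b : 2 ≤ b
    2≤b = ≤-trans (n≤1+n 2) (≤-pred (≤-trans 4≤L (∣⇒≤ L∣1+b)))
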